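{- Let $\Gamma_1,\Gamma_2$ be finite simple graphs and $F:\Gamma_1\to\Gamma_2$ a graph homomorphism. Then the pullback $F^*:\Omega^\bullet(\Gamma_2)\to\Omega^\bullet(\Gamma_1)$ is a linear isomorphism if and only if $F$ is a graph isomorphism.
   Context: For a finite simple graph $\Gamma$, $\Omega^0(\Gamma)$ is the real vector space of functions on the vertices, and $\Omega^1(\Gamma)$ is the space of functions $g$ on ordered pairs $(v,w)$ of adjacent vertices with $g(v,w)=-g(w,v)$; $\Omega^\bullet(\Gamma)=\Omega^0(\Gamma)\oplus\Omega^1(\Gamma)$. For a graph homomorphism $F:\Gamma_1\to\Gamma_2$, the pullback $F^*$ is defined by $F^*f(v)=f(Fv)$ for $f\in\Omega^0(\Gamma_2)$ and $F^*g(v,w)=g(Fv,Fw)$ for $g\in\Omega^1(\Gamma_2)$ and $(v,w)$ an edge of $\Gamma_1$. -}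

module Defs where

open import Level using (Level; _⊔_)
open import Data.Nat using (ℕ)
open import Data.Fin using (Fin)
open import Data.Bool using (Bool; T)
open import Data.Product using (Σ; _×_; _,_)
open import Relation.Binary.PropositionalEquality using (_≡_)
open import Relation.Nullary using (¬_)
open import Algebra.Bundles using (CommutativeRing)

record Graph : Set where
  field
    n     : ℕ
    adj   : Fin n → Fin n → Bool
    adj-sym : ∀ v w → adj v w ≡ adj w v
    adj-irrefl : ∀ v → adj v v ≡ Data.Bool.false

open Graph public

Adj : (Γ : Graph) → Fin (n Γ) → Fin (n Γ) → Set
Adj Γ v w = T (adj Γ v w)

record Hom (Γ₁ Γ₂ : Graph) : Set where
  field
    fun : Fin (n Γ₁) → Fin (n Γ₂)
    pres : ∀ {v w} → Adj Γ₁ v w → Adj Γ₂ (fun v) (fun w)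

open Hom public

idHom : (Γ : Graph) → Hom Γ Γ
idHom Γ = record { fun = λ v → v ; pres = λ p → p }

IsGraphIso : {Γ₁ Γ₂ : Graph} → Hom Γ₁ Γ₂ → Set
IsGraphIso {Γ₁} {Γ₂} F =
  Σ (Hom Γ₂ Γ₁) λ G →
    ((v : Fin (n Γ₁)) → fun G (fun F v) ≡ v) ×
    ((w : Fin (n Γ₂)) → fun F (fun G w) ≡ w)

IsField : ∀ {c ℓ} → CommutativeRing c ℓ → Set (c ⊔ ℓ)
IsField R = ¬ (1# ≈ 0#) × (∀ x → ¬ (x ≈ 0#) → Σ Carrier λ y → x * y ≈ 1#)
  where open CommutativeRing R

module Forms {c ℓ} (R : CommutativeRing c ℓ) where
  open CommutativeRing R

  Ω⁰ : Graph → Set c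
  Ω⁰ Γ = Fin (n Γ) → Carrier

  record Ω¹ (Γ : Graph) : Set (c ⊔ ℓ) where
    field
      val : (v w : Fin (n Γ)) → .(Adj Γ v w) → Carrier
      antisym : ∀ v w .(p : Adj Γ v w) .(q : Adj Γ w v) → val v w p ≈ - val w v q
  open Ω¹ public

  Ω : Graph → Set (c ⊔ ℓ)
  Ω Γ = Ω⁰ Γ × Ω¹ Γ

  _≈Ω_ : {Γ : Graph} → Ω Γ → Ω Γ → Set ℓ
  _≈Ω_ {Γ} (f , g) (f' , g') =
    ((v : Fin (n Γ)) → f v ≈ f' v) ×
    ((v w : Fin (n Γ)) .(p : Adj Γ v w) → val g v w p ≈ val g' v w p)

  _+Ω_ : {Γ : Graph} → Ω Γ → Ω Γ → Ω Γ
  (f , g) +Ω (f' , g') =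
    (λ v → f v + f' v) ,
    record { val = λ v w p → val g v w p + val g' v w p
           ; antisym = λ v w p q → trans (+-cong (antisym g v w p q) (antisym g' v w p q))
                                         (-‿+-comm (val g w v q) (val g' w v q)) }
    where
    open import Algebra.Properties.Ring (CommutativeRing.ring R) using (-‿+-comm)

  _·Ω_ : {Γ : Graph} → Carrier → Ω Γ → Ω Γ
  a ·Ω (f , g) =
    (λ v → a * f v) ,
    record { val = λ v w p → a * val g v w p
           ; antisym = λ v w p q → trans (*-congˡ (antisym g v w p q))
                                         (sym (-‿distribʳ-* a (val g w v q))) }
    where
    open import Algebra.Properties.Ring (CommutativeRing.ring R) using (-‿distribʳ-*)

  pullback : {Γ₁ Γ₂ : Graph} → Hom Γ₁ Γ₂ → Ω Γ₂ → Ω Γ₁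
  pullback F (f , g) =
    (λ v → f (fun F v)) ,
    record { val = λ v w p → val g (fun F v) (fun F w) (pres F p)
           ; antisym = λ v w p q → antisym g (fun F v) (fun F w) (pres F p) (pres F q) }

  IsLinearIso : {Γ₂ Γ₁ : Graph} → (Ω Γ₂ → Ω Γ₁) → Set (c ⊔ ℓ)
  IsLinearIso {Γ₂} {Γ₁} L =
    (∀ x y → L (x +Ω y) ≈Ω (L x +Ω L y)) ×
    (∀ a x → L (a ·Ω x) ≈Ω (a ·Ω L x)) ×
    (∀ x y → L x ≈Ω L y → x ≈Ω y) ×
    (∀ y → Σ (Ω Γ₂) λ x → L x ≈Ω y)

-- If F* is injective, F must hit every vertex (otherwise the indicator of a
-- missed vertex pulls back to 0) and every edge (otherwise the antisymmetric
-- indicator of a missed edge pulls back to 0).  If F* is surjective, F is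
-- injective on vertices, since the indicator of v cannot be a pullback when
-- F u = F v with u ≠ v.  So F is bijective and its inverse preserves
-- adjacency; conversely the pullback along the inverse inverts F*.
module Submission where

open import Defs
open import Level using (_⊔_)
open import Algebra.Bundles using (CommutativeRing)
open import Function.Bundles using (_⇔_; mk⇔)
open import Data.Nat using (ℕ)
open import Data.Bool using (T)
open import Data.Fin using (Fin)
open import Data.Fin.Properties using (_≟_; any?)
open import Data.Product using (Σ; _×_; _,_; proj₁; proj₂; ∃; ∃₂)
open import Data.Empty using (⊥-elim)
open import Relation.Nullary using (¬_; Dec; yes; no; recompute)
open import Relation.Nullary.Decidable using (_×-dec_; T?)
open import Relation.Binary.PropositionalEquality using (_≡_; refl; sym; cong; subst; subst₂)

adj-symmetric : (Γ : Graph) {v w : Fin (n Γ)} → Adj Γ v w → Adj Γ w v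
adj-symmetric Γ {v} {w} = subst T (adj-sym Γ v w)

adj⇒≢ : (Γ : Graph) {v w : Fin (n Γ)} → Adj Γ v w → ¬ v ≡ w
adj⇒≢ Γ {v} p refl = subst T (adj-irrefl Γ v) p

module PullbackProperties {c ℓ} (R : CommutativeRing c ℓ) where
  open CommutativeRing R renaming (refl to ≈-refl; sym to ≈-sym; trans to ≈-trans)
  open Forms R
  open import Algebra.Properties.AbelianGroup +-abelianGroup using (ε⁻¹≈ε; ⁻¹-anti-homo‿-)

  variable
    Γ Γ₁ Γ₂ : Graph

  indicator : ∀ {p} {A : Set p} → Dec A → Carrier
  indicator (yes _) = 1#
  indicator (no _)  = 0#

  indicator-yes : ∀ {p} {A : Set p} → A → (d : Dec A) → indicator d ≈ 1#
  indicator-yes a (yes _) = ≈-refl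
  indicator-yes a (no ¬a) = ⊥-elim (¬a a)

  indicator-no : ∀ {p} {A : Set p} → ¬ A → (d : Dec A) → indicator d ≈ 0#
  indicator-no ¬a (yes a) = ⊥-elim (¬a a)
  indicator-no ¬a (no _)  = ≈-refl

  x-0#≈x : ∀ x → x - 0# ≈ x
  x-0#≈x x = ≈-trans (+-congˡ ε⁻¹≈ε) (+-identityʳ x)

  val-cong : (g : Ω¹ Γ) {a a' b b' : Fin (n Γ)} → a ≡ a' → b ≡ b' →
             .(p : Adj Γ a b) .(p' : Adj Γ a' b') → val g a b p ≈ val g a' b' p'
  val-cong g refl refl p p' = ≈-refl

  0Ω : (Γ : Graph) → Ω Γ
  0Ω Γ = (λ _ → 0#) , record { val = λ _ _ _ → 0# ; antisym = λ _ _ _ _ → ≈-sym ε⁻¹≈ε }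

  vertexForm : (Γ : Graph) → Fin (n Γ) → Ω Γ
  vertexForm Γ w = (λ u → indicator (u ≟ w)) , proj₂ (0Ω Γ)

  edgeIndicator : {m : ℕ} → Fin m → Fin m → Fin m → Fin m → Carrier
  edgeIndicator w w' a b = indicator ((a ≟ w) ×-dec (b ≟ w'))

  edgeForm : (Γ : Graph) → Fin (n Γ) → Fin (n Γ) → Ω Γ
  edgeForm Γ w w' = (λ _ → 0#) , record
    { val     = λ a b _ → e a b - e b a
    ; antisym = λ a b _ _ → ≈-sym (⁻¹-anti-homo‿- (e b a) (e a b))
    }
    where e = edgeIndicator w w'

  edgeForm-on-edge : {w w' : Fin (n Γ)} (p : Adj Γ w w') →
                     val (proj₂ (edgeForm Γ w w')) w w' p ≈ 1#
  edgeForm-on-edge {Γ} {w} {w'} p =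
    ≈-trans (+-cong (indicator-yes (refl , refl) ((w ≟ w) ×-dec (w' ≟ w'))) (-‿cong reversed≈0))
            (x-0#≈x 1#)
    where
    reversed≈0 : edgeIndicator w w' w' w ≈ 0#
    reversed≈0 = indicator-no (λ (w'≡w , _) → adj⇒≢ Γ p (sym w'≡w)) ((w' ≟ w) ×-dec (w ≟ w'))

  edgeForm-off-edge : {w w' a b : Fin (n Γ)} →
                      ¬ (a ≡ w × b ≡ w') → ¬ (b ≡ w × a ≡ w') → .(p : Adj Γ a b) →
                      val (proj₂ (edgeForm Γ w w')) a b p ≈ 0#
  edgeForm-off-edge {w = w} {w'} {a} {b} ¬ab ¬ba _ =
    ≈-trans (+-cong (indicator-no ¬ab ((a ≟ w) ×-dec (b ≟ w')))
                    (-‿cong (indicator-no ¬ba ((b ≟ w) ×-dec (a ≟ w')))))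
            (x-0#≈x 0#)

  PullbackInjective : Hom Γ₁ Γ₂ → Set (c ⊔ ℓ)
  PullbackInjective F = ∀ x y → pullback F x ≈Ω pullback F y → x ≈Ω y

  PullbackSurjective : Hom Γ₁ Γ₂ → Set (c ⊔ ℓ)
  PullbackSurjective {Γ₂ = Γ₂} F = ∀ y → Σ (Ω Γ₂) λ x → pullback F x ≈Ω y

  pullback-+ : (F : Hom Γ₁ Γ₂) (x y : Ω Γ₂) →
               pullback F (x +Ω y) ≈Ω (pullback F x +Ω pullback F y)
  pullback-+ F x y = (λ _ → ≈-refl) , λ _ _ _ → ≈-refl

  pullback-· : (F : Hom Γ₁ Γ₂) (a : Carrier) (x : Ω Γ₂) →
               pullback F (a ·Ω x) ≈Ω (a ·Ω pullback F x)
  pullback-· F a x = (λ _ → ≈-refl) , λ _ _ _ → ≈-refl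

  pullback-inverse : (F : Hom Γ₁ Γ₂) (G : Hom Γ₂ Γ₁) → (∀ v → fun G (fun F v) ≡ v) →
                     (x : Ω Γ₁) → pullback F (pullback G x) ≈Ω x
  pullback-inverse F G GF (f , g) =
    (λ v → reflexive (cong f (GF v))) , λ v v' p → val-cong g (GF v) (GF v') _ p

  pullback-injective : (F : Hom Γ₁ Γ₂) (G : Hom Γ₂ Γ₁) → (∀ w → fun F (fun G w) ≡ w) →
                       PullbackInjective F
  pullback-injective F G FG (f , g) (f' , g') (e⁰ , e¹) =
    (λ w → subst (λ u → f u ≈ f' u) (FG w) (e⁰ (fun G w))) ,
    λ w w' p → ≈-trans (val-cong g (sym (FG w)) (sym (FG w')) p _)
               (≈-trans (e¹ (fun G w) (fun G w') (pres G p)) (val-cong g' (FG w) (FG w') _ p))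

  graphIso⇒pullbackIso : (F : Hom Γ₁ Γ₂) → IsGraphIso F → IsLinearIso (pullback F)
  graphIso⇒pullbackIso F (G , GF , FG) =
    pullback-+ F , pullback-· F , pullback-injective F G FG , λ y → pullback G y , pullback-inverse F G GF y

  module _ (1≉0 : ¬ 1# ≈ 0#) where

    pullback-injective⇒surjective : (F : Hom Γ₁ Γ₂) → PullbackInjective F →
                                    ∀ w → ∃ λ v → fun F v ≡ w
    pullback-injective⇒surjective {Γ₂ = Γ₂} F inj w with any? (λ v → fun F v ≟ w)
    ... | yes hit  = hit
    ... | no  miss = ⊥-elim (1≉0 (≈-trans (≈-sym (indicator-yes refl (w ≟ w)))
                                          (proj₁ (inj (vertexForm Γ₂ w) (0Ω Γ₂) F*δ≈0) w)))
      where
      F*δ≈0 : pullback F (vertexForm Γ₂ w) ≈Ω pullback F (0Ω Γ₂)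
      F*δ≈0 = (λ v → indicator-no (λ Fv≡w → miss (v , Fv≡w)) (fun F v ≟ w)) , λ _ _ _ → ≈-refl

    pullback-injective⇒edge-surjective :
      (F : Hom Γ₁ Γ₂) → PullbackInjective F → ∀ {w w'} → Adj Γ₂ w w' →
      ∃₂ λ v v' → Adj Γ₁ v v' × fun F v ≡ w × fun F v' ≡ w'
    pullback-injective⇒edge-surjective {Γ₁} {Γ₂} F inj {w} {w'} p
      with any? (λ v → any? (λ v' → T? (adj Γ₁ v v') ×-dec (fun F v ≟ w ×-dec fun F v' ≟ w')))
    ... | yes hit  = hit
    ... | no  miss = ⊥-elim (1≉0 (≈-trans (≈-sym (edgeForm-on-edge {Γ₂} p))
                                          (proj₂ (inj (edgeForm Γ₂ w w') (0Ω Γ₂) F*e≈0) w w' p)))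
      where
      F*e≈0 : pullback F (edgeForm Γ₂ w w') ≈Ω pullback F (0Ω Γ₂)
      F*e≈0 = (λ _ → ≈-refl) , λ v v' q →
        let q' = recompute (T? (adj Γ₁ v v')) q in
        edgeForm-off-edge {Γ₂} (λ (a , b) → miss (v , v' , q' , a , b))
                          (λ (a , b) → miss (v' , v , adj-symmetric Γ₁ q' , a , b)) (pres F q)

    pullback-surjective⇒injective : (F : Hom Γ₁ Γ₂) → PullbackSurjective F →
                                    ∀ {u v} → fun F u ≡ fun F v → u ≡ v
    pullback-surjective⇒injective {Γ₁} F srj {u} {v} Fu≡Fv with u ≟ v
    ... | yes u≡v = u≡v
    ... | no  u≢v = ⊥-elim (1≉0 (begin
      1#                 ≈⟨ ≈-sym (indicator-yes refl (v ≟ v)) ⟩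
      indicator (v ≟ v)  ≈⟨ ≈-sym (proj₁ F*x≈δ v) ⟩
      f (fun F v)        ≡⟨ cong f (sym Fu≡Fv) ⟩
      f (fun F u)        ≈⟨ proj₁ F*x≈δ u ⟩
      indicator (u ≟ v)  ≈⟨ indicator-no u≢v (u ≟ v) ⟩
      0#                 ∎))
      where
      open import Relation.Binary.Reasoning.Setoid setoid
      f = proj₁ (proj₁ (srj (vertexForm Γ₁ v)))
      F*x≈δ = proj₂ (srj (vertexForm Γ₁ v))

    pullbackIso⇒graphIso : (F : Hom Γ₁ Γ₂) → IsLinearIso (pullback F) → IsGraphIso F
    pullbackIso⇒graphIso {Γ₁} {Γ₂} F (_ , _ , inj , srj) = G , GF , FG
      where
      G-fun : Fin (n Γ₂) → Fin (n Γ₁)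
      G-fun w = proj₁ (pullback-injective⇒surjective F inj w)

      FG : ∀ w → fun F (G-fun w) ≡ w
      FG w = proj₂ (pullback-injective⇒surjective F inj w)

      GF : ∀ v → G-fun (fun F v) ≡ v
      GF v = pullback-surjective⇒injective F srj (FG (fun F v))

      G-pres : ∀ {w w'} → Adj Γ₂ w w' → Adj Γ₁ (G-fun w) (G-fun w')
      G-pres p with pullback-injective⇒edge-surjective F inj p
      ... | v , v' , q , refl , refl = subst₂ (Adj Γ₁) (sym (GF v)) (sym (GF v')) q

      G : Hom Γ₂ Γ₁
      G = record { fun = G-fun ; pres = G-pres }

lemma2p2 : ∀ {c ℓ} (R : CommutativeRing c ℓ) → IsField R →
    (Γ₁ Γ₂ : Graph) (F : Hom Γ₁ Γ₂) →
    Forms.IsLinearIso R (Forms.pullback R F) ⇔ IsGraphIso F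
lemma2p2 R (1≉0 , _) Γ₁ Γ₂ F = mk⇔ (pullbackIso⇒graphIso 1≉0 F) (graphIso⇒pullbackIso F)
  where open PullbackProperties R
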